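{- Let $\mathcal{A}$ be an integral domain and $n$ a positive integer. Let $u_0,u_1,\dots,u_n,a,b\in\mathcal{A}$. Suppose that: (1) each of $u_0,u_1,\dots,u_n$ divides $a$ in $\mathcal{A}$; (2) for each $i\in\{0,1,\dots,n\}$, the element $\prod_{0\le j\le n,\ j\ne i}(u_i-u_j)$ divides $b$ in $\mathcal{A}$. Then the product $ab$ is a multiple (in $\mathcal{A}$) of the product $u_0u_1\cdots u_n$. -}

module Defs where

open import Level using (Level; _⊔_) renaming (suc to lsuc)
open import Algebra.Bundles using (CommutativeRing)
open import Data.Nat using (ℕ)
open import Data.Fin using (Fin; zero; suc)
open import Data.Product using (∃; _×_)
open import Data.Sum using (_⊎_)
open import Relation.Nullary using (¬_)
open import Relation.Binary.PropositionalEquality using (_≡_)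

record IntegralDomain (c ℓ : Level) : Set (lsuc (c ⊔ ℓ)) where
  field
    commutativeRing : CommutativeRing c ℓ
  open CommutativeRing commutativeRing public
  field
    1#≉0#         : ¬ (1# ≈ 0#)
    noZeroDivisors : ∀ x y → x * y ≈ 0# → (x ≈ 0#) ⊎ (y ≈ 0#)

module _ {c ℓ} (R : CommutativeRing c ℓ) where
  open CommutativeRing R using (Carrier; _≈_; _*_; 1#)

  Divides : Carrier → Carrier → Set (c ⊔ ℓ)
  Divides x y = ∃ λ q → y ≈ q * x

  prod : (m : ℕ) → (Fin m → Carrier) → Carrier
  prod ℕ.zero    f = 1#
  prod (ℕ.suc m) f = f zero * prod m (λ i → f (suc i))

  prodExcept : (m : ℕ) → Fin m → (Fin m → Carrier) → Carrier
  prodExcept (ℕ.suc m) zero    g = prod m (λ j → g (suc j))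
  prodExcept (ℕ.suc m) (suc i) g = g zero * prodExcept m i (λ j → g (suc j))

-- Write b = qᵢ ∏_{j≠i} (uᵢ - uⱼ). The "polynomial" L(X) = Σᵢ qᵢ ∏_{j≠i} (X - uⱼ) has
-- degree at most n and takes the value b at every node uᵢ, so by Lagrange interpolation
-- it is the constant b, unless two nodes coincide, in which case b = 0. Evaluating at
-- X = 0 and writing a = rᵢ uᵢ gives a b = a L(0) = Σᵢ (-rᵢ) qᵢ ∏ⱼ (0 - uⱼ), a multiple
-- of ∏ⱼ uⱼ.
--
-- Interpolation is replaced by an induction on the number of nodes. Dropping u₀ and
-- replacing qᵢ by qᵢ (uᵢ - u₀) preserves the hypothesis on b, and splits
-- L(X) = (q₀ + Σ_{i≥1} qᵢ) ∏_{j≥1} (X - uⱼ) + L'(X). Evaluating at u₀, where L(u₀) = b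
-- and L'(u₀) = b, shows that (q₀ + Σ_{i≥1} qᵢ) ∏_{j≥1} (u₀ - uⱼ) = 0; in a domain
-- either the first factor vanishes, so L = L' = b, or the second does, so b = 0.

module Submission where

open import Defs
open import Data.Nat using (ℕ; zero; suc; _≤_)
open import Data.Fin using (Fin; zero; suc)
open import Algebra.Bundles using (CommutativeRing)
open import Data.Product using (_,_; proj₁; proj₂)
open import Data.Sum using (_⊎_; inj₁; inj₂; [_,_]′)
open import Function using (_∘_)

module CommutativeRingProperties {c ℓ} (R : CommutativeRing c ℓ) where
  open CommutativeRing R hiding (zero)
  open import Algebra.Properties.Ring ring
    using (-1*x≈-x; -‿distribˡ-*; -‿distribʳ-*; -‿involutive)
  open import Algebra.Properties.CommutativeSemigroup *-commutativeSemigroup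
    using (x∙yz≈y∙xz; interchange)
  open import Algebra.Properties.Semiring.Sum semiring
    using (sum-syntax; sum-cong-≋; ∑-distrib-+; *-distribˡ-sum; *-distribʳ-sum; sum-replicate-zero)
  open import Relation.Binary.Reasoning.Setoid setoid

  Divides-respʳ : ∀ {x y z} → y ≈ z → Divides R x y → Divides R x z
  Divides-respʳ y≈z (s , y≈sx) = s , trans (sym y≈z) y≈sx

  prod-Divides : ∀ m (f g : Fin m → Carrier) →
                 (∀ j → Divides R (f j) (g j)) → Divides R (prod R m f) (prod R m g)
  prod-Divides zero    f g f∣g = 1# , sym (*-identityˡ 1#)
  prod-Divides (suc m) f g f∣g =
    let t , g₀≈tf₀ = f∣g zero
        s , g⁺≈sf⁺ = prod-Divides m (f ∘ suc) (g ∘ suc) (f∣g ∘ suc)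
    in t * s , trans (*-cong g₀≈tf₀ g⁺≈sf⁺) (interchange t (f zero) s (prod R m (f ∘ suc)))

  *-prodExcept : ∀ m i (g : Fin m → Carrier) → g i * prodExcept R m i g ≈ prod R m g
  *-prodExcept (suc m) zero    g = refl
  *-prodExcept (suc m) (suc i) g =
    trans (x∙yz≈y∙xz (g (suc i)) (g zero) _) (*-congˡ (*-prodExcept m i (g ∘ suc)))

  [x-y]+[y-z]≈x-z : ∀ x y z → (x - y) + (y - z) ≈ x - z
  [x-y]+[y-z]≈x-z x y z = begin
    (x - y) + (y - z)   ≈⟨ +-assoc x (- y) (y - z) ⟩
    x + (- y + (y - z)) ≈⟨ +-congˡ (+-assoc (- y) y (- z)) ⟨
    x + ((- y + y) - z) ≈⟨ +-congˡ (+-congʳ (-‿inverseˡ y)) ⟩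
    x + (0# - z)        ≈⟨ +-congˡ (+-identityˡ (- z)) ⟩
    x - z               ∎

  -x*[0-y]≈x*y : ∀ x y → - x * (0# - y) ≈ x * y
  -x*[0-y]≈x*y x y = begin
    - x * (0# - y) ≈⟨ *-congˡ (+-identityˡ (- y)) ⟩
    - x * - y      ≈⟨ -‿distribˡ-* x (- y) ⟨
    - (x * - y)    ≈⟨ -‿cong (-‿distribʳ-* x y) ⟨
    - - (x * y)    ≈⟨ -‿involutive (x * y) ⟩
    x * y          ∎

  lagrangeSum : (m : ℕ) → (u q : Fin m → Carrier) → Carrier → Carrier
  lagrangeSum m u q c = ∑[ i < m ] (q i * prodExcept R m i (λ j → c - u j))

  -- Chosen so that q′ᵢ ∏_{j≠i, j≥1} (uᵢ - uⱼ) = qᵢ ∏_{j≠i} (uᵢ - uⱼ).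
  reducedWeights : (m : ℕ) → (u q : Fin (suc m) → Carrier) → Fin m → Carrier
  reducedWeights m u q i = q (suc i) * (u (suc i) - u zero)

  lagrangeSum-suc : ∀ m (u q : Fin (suc m) → Carrier) c →
    lagrangeSum (suc m) u q c ≈
      (q zero + ∑[ i < m ] q (suc i)) * prod R m (λ j → c - u (suc j))
        + lagrangeSum m (u ∘ suc) (reducedWeights m u q) c
  lagrangeSum-suc m u q c = begin
    q zero * A + ∑[ i < m ] (q (suc i) * ((c - u zero) * pe i))
      ≈⟨ +-congˡ (sum-cong-≋ split) ⟩
    q zero * A + ∑[ i < m ] (q (suc i) * A + q′ i * pe i)
      ≈⟨ +-congˡ (∑-distrib-+ (λ i → q (suc i) * A) (λ i → q′ i * pe i)) ⟩
    q zero * A + (∑[ i < m ] (q (suc i) * A) + L′)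
      ≈⟨ +-congˡ (+-congʳ (*-distribʳ-sum A (q ∘ suc))) ⟨
    q zero * A + (σ * A + L′)
      ≈⟨ +-assoc (q zero * A) (σ * A) L′ ⟨
    (q zero * A + σ * A) + L′
      ≈⟨ +-congʳ (distribʳ A (q zero) σ) ⟨
    (q zero + σ) * A + L′ ∎
    where
    A : Carrier
    A = prod R m (λ j → c - u (suc j))
    pe : Fin m → Carrier
    pe i = prodExcept R m i (λ j → c - u (suc j))
    q′ : Fin m → Carrier
    q′ = reducedWeights m u q
    σ : Carrier
    σ = ∑[ i < m ] q (suc i)
    L′ : Carrier
    L′ = lagrangeSum m (u ∘ suc) q′ c
    split : ∀ i → q (suc i) * ((c - u zero) * pe i) ≈ q (suc i) * A + q′ i * pe i
    split i = begin
      qᵢ * ((c - u zero) * pe i)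
        ≈⟨ *-congˡ (*-congʳ ([x-y]+[y-z]≈x-z c uᵢ (u zero))) ⟨
      qᵢ * (((c - uᵢ) + (uᵢ - u zero)) * pe i)
        ≈⟨ *-congˡ (distribʳ (pe i) (c - uᵢ) (uᵢ - u zero)) ⟩
      qᵢ * ((c - uᵢ) * pe i + (uᵢ - u zero) * pe i)
        ≈⟨ distribˡ qᵢ ((c - uᵢ) * pe i) ((uᵢ - u zero) * pe i) ⟩
      qᵢ * ((c - uᵢ) * pe i) + qᵢ * ((uᵢ - u zero) * pe i)
        ≈⟨ +-cong (*-congˡ (*-prodExcept m i (λ j → c - u (suc j))))
                  (sym (*-assoc qᵢ (uᵢ - u zero) (pe i))) ⟩
      qᵢ * A + q′ i * pe i ∎
      where
      qᵢ uᵢ : Carrier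
      qᵢ = q (suc i)
      uᵢ = u (suc i)

  lagrangeSum-at-first-node : ∀ m (u q : Fin (suc m) → Carrier) →
    lagrangeSum (suc m) u q (u zero) ≈ q zero * prodExcept R (suc m) zero (λ j → u zero - u j)
  lagrangeSum-at-first-node m u q =
    trans (+-congˡ (trans (sum-cong-≋ vanishes) (sum-replicate-zero m))) (+-identityʳ _)
    where
    vanishes : ∀ i → q (suc i) * ((u zero - u zero) * prodExcept R m i (λ j → u zero - u (suc j))) ≈ 0#
    vanishes i = trans (*-congˡ (trans (*-congʳ (-‿inverseʳ (u zero))) (zeroˡ _))) (zeroʳ _)

  prod-Divides-*-lagrangeSum-at-0 : ∀ m (u q : Fin m → Carrier) a →
    (∀ i → Divides R (u i) a) → Divides R (prod R m u) (a * lagrangeSum m u q 0#)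
  prod-Divides-*-lagrangeSum-at-0 m u q a u∣a =
    let s , N≈sΠ = prod-Divides m u (λ j → 0# - u j) (λ j → - 1# , 0#-x≈-1*x (u j))
    in K * s , (begin
      a * lagrangeSum m u q 0#        ≈⟨ *-distribˡ-sum a (λ i → q i * pe i) ⟩
      ∑[ i < m ] (a * (q i * pe i))   ≈⟨ sum-cong-≋ term ⟩
      ∑[ i < m ] ((- r i * q i) * N)  ≈⟨ *-distribʳ-sum N (λ i → - r i * q i) ⟨
      K * N                           ≈⟨ *-congˡ N≈sΠ ⟩
      K * (s * prod R m u)            ≈⟨ *-assoc K s (prod R m u) ⟨
      (K * s) * prod R m u            ∎)
    where
    r : Fin m → Carrier
    r i = proj₁ (u∣a i)
    pe : Fin m → Carrier
    pe i = prodExcept R m i (λ j → 0# - u j)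
    N : Carrier
    N = prod R m (λ j → 0# - u j)
    K : Carrier
    K = ∑[ i < m ] (- r i * q i)
    0#-x≈-1*x : ∀ x → 0# - x ≈ - 1# * x
    0#-x≈-1*x x = trans (+-identityˡ (- x)) (sym (-1*x≈-x x))
    term : ∀ i → a * (q i * pe i) ≈ (- r i * q i) * N
    term i = begin
      a * (q i * pe i)                    ≈⟨ *-congʳ (trans (proj₂ (u∣a i)) (sym (-x*[0-y]≈x*y (r i) (u i)))) ⟩
      (- r i * (0# - u i)) * (q i * pe i) ≈⟨ interchange (- r i) (0# - u i) (q i) (pe i) ⟩
      (- r i * q i) * ((0# - u i) * pe i) ≈⟨ *-congˡ (*-prodExcept m i (λ j → 0# - u j)) ⟩
      (- r i * q i) * N                   ∎

module IntegralDomainProperties {c ℓ} (𝒜 : IntegralDomain c ℓ) where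
  open IntegralDomain 𝒜 hiding (zero)
  open CommutativeRingProperties commutativeRing
  open import Algebra.Properties.Ring ring using (+-identityˡ-unique)
  open import Algebra.Properties.Semiring.Sum semiring using (sum-syntax)
  open import Relation.Binary.Reasoning.Setoid setoid

  lagrangeSum-extend : ∀ m (u q : Fin (suc m) → Carrier) b →
    b ≈ q zero * prodExcept commutativeRing (suc m) zero (λ j → u zero - u j) →
    (∀ c → lagrangeSum m (u ∘ suc) (reducedWeights m u q) c ≈ b) →
    b ≈ 0# ⊎ (∀ c → lagrangeSum (suc m) u q c ≈ b)
  lagrangeSum-extend m u q b b≈q₀A₀ L′≈b =
    [ (λ q₀+σ≈0 → inj₂ (constant q₀+σ≈0)) , (λ A₀≈0 → inj₁ (b≈0 A₀≈0)) ]′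
      (noZeroDivisors (q zero + σ) (A (u zero)) leading-term-vanishes)
    where
    σ : Carrier
    σ = ∑[ i < m ] q (suc i)
    A : Carrier → Carrier
    A c = prod commutativeRing m (λ j → c - u (suc j))
    leading-term-vanishes : (q zero + σ) * A (u zero) ≈ 0#
    leading-term-vanishes = +-identityˡ-unique _ b (begin
      (q zero + σ) * A (u zero) + b ≈⟨ +-congˡ (L′≈b (u zero)) ⟨
      (q zero + σ) * A (u zero) + lagrangeSum m (u ∘ suc) (reducedWeights m u q) (u zero)
        ≈⟨ lagrangeSum-suc m u q (u zero) ⟨
      lagrangeSum (suc m) u q (u zero) ≈⟨ lagrangeSum-at-first-node m u q ⟩
      q zero * A (u zero)              ≈⟨ b≈q₀A₀ ⟨
      b                                ∎)
    constant : q zero + σ ≈ 0# → ∀ c → lagrangeSum (suc m) u q c ≈ b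
    constant q₀+σ≈0 c = begin
      lagrangeSum (suc m) u q c
        ≈⟨ lagrangeSum-suc m u q c ⟩
      (q zero + σ) * A c + lagrangeSum m (u ∘ suc) (reducedWeights m u q) c
        ≈⟨ +-cong (trans (*-congʳ q₀+σ≈0) (zeroˡ (A c))) (L′≈b c) ⟩
      0# + b
        ≈⟨ +-identityˡ b ⟩
      b ∎
    b≈0 : A (u zero) ≈ 0# → b ≈ 0#
    b≈0 A₀≈0 = trans b≈q₀A₀ (trans (*-congˡ A₀≈0) (zeroʳ (q zero)))

  lagrangeSum-constant : ∀ n (u q : Fin (suc n) → Carrier) b →
    (∀ i → b ≈ q i * prodExcept commutativeRing (suc n) i (λ j → u i - u j)) →
    b ≈ 0# ⊎ (∀ c → lagrangeSum (suc n) u q c ≈ b)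
  lagrangeSum-constant zero    u q b b≈ = inj₂ λ c → trans (+-identityʳ _) (sym (b≈ zero))
  lagrangeSum-constant (suc m) u q b b≈ =
    [ inj₁ , lagrangeSum-extend (suc m) u q b (b≈ zero) ]′
      (lagrangeSum-constant m (u ∘ suc) (reducedWeights (suc m) u q) b
        (λ i → trans (b≈ (suc i)) (sym (*-assoc _ _ _))))

lemma1 : ∀ {c ℓ} (𝒜 : IntegralDomain c ℓ) (n : ℕ) → (1 ≤ n) → (u : Fin (suc n) → IntegralDomain.Carrier 𝒜) → (a b : IntegralDomain.Carrier 𝒜) → (∀ i → Divides (IntegralDomain.commutativeRing 𝒜) (u i) a) → (∀ i → Divides (IntegralDomain.commutativeRing 𝒜) (prodExcept (IntegralDomain.commutativeRing 𝒜) (suc n) i (λ j → IntegralDomain._-_ 𝒜 (u i) (u j))) b) → Divides (IntegralDomain.commutativeRing 𝒜) (prod (IntegralDomain.commutativeRing 𝒜) (suc n) u) (IntegralDomain._*_ 𝒜 a b)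
lemma1 𝒜 n _ u a b u∣a prodExcept∣b =
  [ (λ b≈0 → Divides-respʳ (sym (trans (*-congˡ b≈0) (zeroʳ a))) (0# , sym (zeroˡ _)))
  , (λ L≈b → Divides-respʳ (*-congˡ (L≈b 0#)) (prod-Divides-*-lagrangeSum-at-0 (suc n) u q a u∣a))
  ]′ (lagrangeSum-constant n u q b (proj₂ ∘ prodExcept∣b))
  where
  open IntegralDomain 𝒜 hiding (zero)
  open CommutativeRingProperties commutativeRing
  open IntegralDomainProperties 𝒜
  q : Fin (suc n) → Carrier
  q = proj₁ ∘ prodExcept∣b
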